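{- For every $k\ge1$ the diagram $$\begin{array}{ccc}H^1(C/\mathcal{I}^kC)&\xrightarrow{\psi^{(k)}}&H^2(\mathcal{I}^kC/\mathcal{I}^{k+1}C)\\ \downarrow\pi&&\downarrow\rho\\ E_k^{0,1}&\xrightarrow{\beta^{(k)}}&E_k^{k,2-k}\end{array}$$ commutes, i.e. $\rho\circ\psi^{(k)}=\beta^{(k)}\circ\pi$; here $\pi$ and $\rho$ are surjective.
   Context: Let $\mathcal{R}$ be a (possibly non-commutative) ring, $\mathcal{I}\subseteq\mathcal{R}$ a two-sided ideal (with $\mathcal{I}^j=\mathcal{R}$ for $j\le0$), and $C=[C^1\xrightarrow{d}C^2]$ a complex of left $\mathcal{R}$-modules concentrated in degrees 1 and 2. The filtration $\{\mathcal{I}^iC\}$ gives a spectral sequence: $Z_k^{i,j}=\ker(\mathcal{I}^iC^{i+j}\xrightarrow{d}C^{i+j+1}/\mathcal{I}^{i+k}C^{i+j+1})$, $B_k^{i,j}=\mathcal{I}^iC^{i+j}\cap d(\mathcal{I}^{i-k}C^{i+j-1})$, $E_k^{i,j}=Z_k^{i,j}/(Z_{k-1}^{i+1,j-1}+B_{k-1}^{i,j})$, and $d_k^{i,j}:E_k^{i,j}\to E_k^{i+k,j+1-k}$ is induced by $d$; $E_1^{i,j}\simeq H^{i+j}(\mathcal{I}^iC/\mathcal{I}^{i+1}C)$. The $k$-th derived Bockstein map is $\beta^{(k)}:=d_k^{0,1}:E_k^{0,1}\to E_k^{k,2-k}$. The $k$-th generalized Bockstein map $\psi^{(k)}:H^1(C/\mathcal{I}^kC)\to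 H^2(\mathcal{I}^kC/\mathcal{I}^{k+1}C)$ is the connecting homomorphism of $0\to\mathcal{I}^kC/\mathcal{I}^{k+1}C\to C/\mathcal{I}^{k+1}C\to C/\mathcal{I}^kC\to0$. $\rho:E_1^{k,2-k}=H^2(\mathcal{I}^kC/\mathcal{I}^{k+1}C)\twoheadrightarrow E_k^{k,2-k}$ is the natural surjection. Since $E_k^{0,1}=\{a\in C^1:da\in\mathcal{I}^kC^2\}/\{a\in\mathcal{I}C^1:da\in\mathcal{I}^kC^2\}$, $\pi:H^1(C/\mathcal{I}^kC)\twoheadrightarrow E_k^{0,1}$ is the natural surjection sending the class of $a\in C^1$ (with $da\in\mathcal{I}^kC^2$) modulo $\mathcal{I}^kC^1$ to the class of $a$. -}

module Defs where

open import Level using (Level; _⊔_; Lift; lift) renaming (suc to lsuc)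
open import Data.Nat using (ℕ; zero; suc; _∸_)
open import Data.Integer using (ℤ; +_; -[1+_]; 1ℤ) renaming (_+_ to _+ℤ_; _-_ to _-ℤ_)
open import Data.Product using (Σ; ∃; _×_; _,_)
open import Data.Unit.Polymorphic using (⊤)
open import Relation.Binary.PropositionalEquality using (_≡_; _≢_; subst)
open import Relation.Nullary using (¬_)
open import Algebra.Bundles using (Ring)
open import Algebra.Module.Bundles using (LeftModule)
open import Algebra.Module.Morphism.Structures using (module LeftModuleMorphisms)

record TwoSidedIdeal {c ℓ} (R : Ring c ℓ) ι : Set (c ⊔ ℓ ⊔ lsuc ι) where
  open Ring R using (Carrier; _≈_; _+_; _*_; -_; 0#)
  field
    _∈I      : Carrier → Set ι
    ∈I-resp  : ∀ {x y} → x ≈ y → x ∈I → y ∈I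
    ∈I-0#    : 0# ∈I
    ∈I-+     : ∀ {x y} → x ∈I → y ∈I → (x + y) ∈I
    ∈I--     : ∀ {x} → x ∈I → (- x) ∈I
    ∈I-*ˡ    : ∀ r {x} → x ∈I → (r * x) ∈I
    ∈I-*ʳ    : ∀ r {x} → x ∈I → (x * r) ∈I

record TwoTermComplex {c ℓ} (R : Ring c ℓ) m ℓm : Set (c ⊔ ℓ ⊔ lsuc (m ⊔ ℓm)) where
  field
    C    : ℤ → LeftModule R m ℓm
  open module Cn (n : ℤ) = LeftModule (C n)
    using (Carrierᴹ; _≈ᴹ_; 0ᴹ)
  field
    d    : ∀ n → Carrierᴹ n → Carrierᴹ (n +ℤ 1ℤ)
    d-hom : ∀ n → LeftModuleMorphisms.IsLeftModuleHomomorphism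
              (LeftModule.rawLeftModule (C n))
              (LeftModule.rawLeftModule (C (n +ℤ 1ℤ))) (d n)
    d∘d  : ∀ n x → _≈ᴹ_ ((n +ℤ 1ℤ) +ℤ 1ℤ) (d (n +ℤ 1ℤ) (d n x)) (0ᴹ ((n +ℤ 1ℤ) +ℤ 1ℤ))
    concentrated : ∀ n → n ≢ + 1 → n ≢ + 2 → ∀ x → _≈ᴹ_ n x (0ᴹ n)

module IdealPowers {c ℓ ι} (R : Ring c ℓ) (I : TwoSidedIdeal R ι) where
  open Ring R using (Carrier; _≈_; _+_; _*_; -_; 0#)
  open TwoSidedIdeal I

  -- I^j for j : ℕ: I^0 = R, I^(j+1) = I · I^j  (additive subgroup generated
  -- by products x*y with x ∈ I, y ∈ I^j; this is the product ideal)
  data InPow : ℕ → Carrier → Set (c ⊔ ℓ ⊔ ι) where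
    pow-zero : ∀ x → InPow zero x
    pow-mul  : ∀ {j x y} → x ∈I → InPow j y → InPow (suc j) (x * y)
    pow-0#   : ∀ {j} → InPow j 0#
    pow-+    : ∀ {j x y} → InPow j x → InPow j y → InPow j (x + y)
    pow-resp : ∀ {j x y} → x ≈ y → InPow j x → InPow j y

  InPowℤ : ℤ → Carrier → Set (c ⊔ ℓ ⊔ ι)
  InPowℤ (+ j)     x = InPow j x
  InPowℤ -[1+ _ ]  x = ⊤

  -- the submodule I^j M of a left module M: generated by r·x with r ∈ I^j
  data Filt {m ℓm} (M : LeftModule R m ℓm) (j : ℤ)
       : LeftModule.Carrierᴹ M → Set (c ⊔ ℓ ⊔ ι ⊔ m ⊔ ℓm) where
    f-gen  : ∀ {r} x → InPowℤ j r → Filt M j (LeftModule._*ₗ_ M r x)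
    f-0    : Filt M j (LeftModule.0ᴹ M)
    f-+    : ∀ {x y} → Filt M j x → Filt M j y → Filt M j (LeftModule._+ᴹ_ M x y)
    f-resp : ∀ {x y} → LeftModule._≈ᴹ_ M x y → Filt M j x → Filt M j y

module SpectralSequence {c ℓ ι m ℓm} (R : Ring c ℓ) (I : TwoSidedIdeal R ι)
                        (Cx : TwoTermComplex R m ℓm) where
  open IdealPowers R I public
  open TwoTermComplex Cx
  open module Cm (n : ℤ) = LeftModule (C n) using (Carrierᴹ; _≈ᴹ_)

  private
    L : Level
    L = c ⊔ ℓ ⊔ ι ⊔ m ⊔ ℓm

  F : ℤ → (n : ℤ) → Carrierᴹ n → Set L
  F j n = Filt (C n) j

  _-ᴹ_ : ∀ {n} → Carrierᴹ n → Carrierᴹ n → Carrierᴹ n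
  _-ᴹ_ {n} x y = LeftModule._+ᴹ_ (C n) x (LeftModule.-ᴹ_ (C n) y)

  _+ᴹ_ : ∀ {n} → Carrierᴹ n → Carrierᴹ n → Carrierᴹ n
  _+ᴹ_ {n} = LeftModule._+ᴹ_ (C n)

  -- w ∈ d(I^j C^(n-1))   (the source degree m is the unique m with m+1 = n)
  InImage : ℤ → (n : ℤ) → Carrierᴹ n → Set L
  InImage j n w = Σ ℤ λ m → Σ (m +ℤ 1ℤ ≡ n) λ e → Σ (Carrierᴹ m) λ y →
                  F j m y × _≈ᴹ_ n w (subst Carrierᴹ e (d m y))

  -- Z_k^{i,j} ⊆ C^n with n = i + j (we index by i and total degree n)
  Z : ℕ → ℤ → (n : ℤ) → Carrierᴹ n → Set L
  Z k i n x = F i n x × F (i +ℤ + k) (n +ℤ 1ℤ) (d n x)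

  B : ℕ → ℤ → (n : ℤ) → Carrierᴹ n → Set L
  B k i n x = F i n x × InImage (i -ℤ + k) n x

  -- E_k^{i,j} = Z_k^{i,j} / (Z_{k-1}^{i+1,j-1} + B_{k-1}^{i,j})  (k ≥ 1)
  E : ℕ → ℤ → ℤ → Set L
  E k i n = Σ (Carrierᴹ n) (Z k i n)

  _≈E_ : ∀ {k i n} → E k i n → E k i n → Set L
  _≈E_ {k} {i} {n} (x , _) (y , _) =
    Σ (Carrierᴹ n) λ z → Σ (Carrierᴹ n) λ w →
      Z (k ∸ 1) (i +ℤ 1ℤ) n z × B (k ∸ 1) i n w × _≈ᴹ_ n (x -ᴹ y) (z +ᴹ w)

  dk : ∀ k i n → E k i n → E k (i +ℤ + k) (n +ℤ 1ℤ)
  dk k i n (x , (p , q)) =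
    d n x , (q , f-resp (LeftModule.≈ᴹ-sym (C _) (d∘d n x)) f-0)

  β : ∀ k → E k (+ 0) (+ 1) → E k (+ k) (+ 2)
  β k = dk k (+ 0) (+ 1)

  -- H^n(I^a C / I^b C)  (a ≤ b): cocycles x ∈ I^a C^n with dx ∈ I^b C^(n+1),
  -- modulo I^b C^n + d(I^a C^(n-1)).  For a = 0 this is H^n(C / I^b C).
  H : ℤ → ℤ → ℤ → Set L
  H a b n = Σ (Carrierᴹ n) λ x → F a n x × F b (n +ℤ 1ℤ) (d n x)

  _≈H_ : ∀ {a b n} → H a b n → H a b n → Set L
  _≈H_ {a} {b} {n} (x , _) (y , _) =
    Σ (Carrierᴹ n) λ z → Σ (Carrierᴹ n) λ w →
      F b n z × InImage a n w × _≈ᴹ_ n (x -ᴹ y) (z +ᴹ w)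

  -- ψ^(k) : H^1(C/I^k C) → H^2(I^k C / I^(k+1) C), the connecting map of
  -- 0 → I^k C/I^(k+1) C → C/I^(k+1) C → C/I^k C → 0: lift the class of a
  -- to C/I^(k+1)C (representative a), apply d, pull back (representative da).
  ψ : ∀ k → H (+ 0) (+ k) (+ 1) → H (+ k) (+ suc k) (+ 2)
  ψ k (x , (p , q)) =
    d (+ 1) x , (q , f-resp (LeftModule.≈ᴹ-sym (C _) (d∘d (+ 1) x)) f-0)

  π : ∀ k → H (+ 0) (+ k) (+ 1) → E k (+ 0) (+ 1)
  π k (x , pq) = x , pq

  private
    3≢1 : + 3 ≢ + 1
    3≢1 ()
    3≢2 : + 3 ≢ + 2
    3≢2 ()

  -- ρ : E_1^{k,2-k} = H^2(I^k C/I^(k+1) C) ↠ E_k^{k,2-k}, identity on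
  -- representatives (Z_k^{k,2-k} = Z_1^{k,2-k} since C^3 = 0)
  ρ : ∀ k → H (+ k) (+ suc k) (+ 2) → E k (+ k) (+ 2)
  ρ k (y , (p , q)) =
    y , (p , f-resp (LeftModule.≈ᴹ-sym (C _) (concentrated (+ 3) 3≢1 3≢2 _)) f-0)

{-# OPTIONS --safe #-}
-- Every map in the square acts on representatives: π and ρ are the identity, and
-- both ψ^(k) and β^(k) = d_k^{0,1} are induced by d.  Hence both composites send
-- the class of a to the class of da, and π, ρ are onto because they do not change
-- representatives (an element of C^2 is automatically a cocycle, as C^3 = 0).
module Submission where

open import Defs
open import Data.Nat using (ℕ; suc; _≤_)
open import Data.Integer using (ℤ; +_; 1ℤ) renaming (_+_ to _+ℤ_)
open import Data.Product using (_×_; ∃; _,_; proj₁)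
open import Relation.Binary.PropositionalEquality using (_≡_; refl)
open import Algebra.Bundles using (Ring)
open import Algebra.Module.Bundles using (LeftModule)
open import Algebra.Module.Morphism.Structures using (module LeftModuleMorphisms)

module SpectralSequenceProperties {c ℓ ι m ℓm} (R : Ring c ℓ) (I : TwoSidedIdeal R ι)
                                  (Cx : TwoTermComplex R m ℓm) where

  open SpectralSequence R I Cx
  open TwoTermComplex Cx
  open module Cᴹ (n : ℤ) = LeftModule (C n)
    using (_≈ᴹ_; 0ᴹ; ≈ᴹ-sym; ≈ᴹ-trans; -ᴹ‿inverseʳ; +ᴹ-identityˡ)

  d-0ᴹ : ∀ n → _≈ᴹ_ (n +ℤ 1ℤ) (0ᴹ (n +ℤ 1ℤ)) (d n (0ᴹ n))
  d-0ᴹ n = ≈ᴹ-sym _ (LeftModuleMorphisms.IsLeftModuleHomomorphism.0ᴹ-homo (d-hom n))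

  F-C³ : ∀ j x → F j (+ 3) x
  F-C³ j x = f-resp (≈ᴹ-sym _ (concentrated (+ 3) (λ ()) (λ ()) x)) f-0

  ≈E-reflexive : ∀ {k i} n (e e′ : E k i (n +ℤ 1ℤ)) → proj₁ e ≡ proj₁ e′ →
                 _≈E_ {k} {i} {n +ℤ 1ℤ} e e′
  ≈E-reflexive n (x , _) (.x , _) refl =
    0ᴹ _ , 0ᴹ _ ,
    (f-0 , f-resp (d-0ᴹ _) f-0) ,
    (f-0 , (n , refl , 0ᴹ n , f-0 , d-0ᴹ n)) ,
    ≈ᴹ-trans _ (-ᴹ‿inverseʳ _ x) (≈ᴹ-sym _ (+ᴹ-identityˡ _ _))

propositionA4 : ∀ {c ℓ ι m ℓm} (R : Ring c ℓ) (I : TwoSidedIdeal R ι)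
                  (Cx : TwoTermComplex R m ℓm) (k : ℕ) → 1 ≤ k →
                  let open SpectralSequence R I Cx in
                  (∀ a → _≈E_ {k} {+ k} {+ 2} (ρ k (ψ k a)) (β k (π k a)))
                  × (∀ e → ∃ λ a → _≈E_ {k} {+ 0} {+ 1} (π k a) e)
                  × (∀ e → ∃ λ b → _≈E_ {k} {+ k} {+ 2} (ρ k b) e)
propositionA4 R I Cx k _ = square-commutes , π-surjective , ρ-surjective
  where
  open SpectralSequence R I Cx
  open SpectralSequenceProperties R I Cx

  square-commutes : ∀ a → _≈E_ {k} {+ k} {+ 2} (ρ k (ψ k a)) (β k (π k a))
  square-commutes a@(_ , _) = ≈E-reflexive (+ 1) (ρ k (ψ k a)) (β k (π k a)) refl

  π-surjective : ∀ e → ∃ λ a → _≈E_ {k} {+ 0} {+ 1} (π k a) e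
  π-surjective e = e , ≈E-reflexive (+ 0) e e refl

  ρ-surjective : ∀ e → ∃ λ b → _≈E_ {k} {+ k} {+ 2} (ρ k b) e
  ρ-surjective e@(y , p , _) = b , ≈E-reflexive (+ 1) (ρ k b) e refl
    where
    b : H (+ k) (+ suc k) (+ 2)
    b = y , p , F-C³ _ _
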